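{- Let $G$ be a semigroup. For every IP-set $A\subseteq G$ and every $g\in A$, the set $\partial_g A$ contains an IP-set; hence $A\subseteq \Delta(A)$, where $\Delta$ is computed with respect to the filter ${\rm IP}^\ast$.
   Context: For a sequence $(g_i)_{i<n}$, $n\in\mathbb{N}\cup\{\infty\}$, in $G$ and a finite nonempty $\alpha\subseteq\{i : i<n\}$, let $g_\alpha = g_{i_1}g_{i_2}\cdots g_{i_k}$ where $i_1>i_2>\dots>i_k$ enumerate $\alpha$ in decreasing order, and $g_\emptyset = 1_G$. $\mathrm{FP}(g_i)_{i<n} := \{g_\alpha : \alpha \text{ finite}\}$. An IP-set is a set of the form $\mathrm{FP}(g_i)_{i\in\mathbb{N}}$. ${\rm IP}^\ast$ is the filter of sets meeting every IP-set; by Hindman's theorem, a set is ${\rm IP}^\ast$-positive (not ${\rm IP}^\ast$-small, i.e. its complement is not in ${\rm IP}^\ast$) iff it contains an IP-set. For $A\subseteq G$, $g\in G$: $Ag^{ -1}:=\{h : hg\in A\}$, $\partial_gA := A\cap Ag^{ -1}$, and $\Delta(A) := \{g\in G : \partial_g A \text{ is } {\rm IP}^\ast\text{ -positive}\}$. -}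

module Defs where

open import Level using (Level; _⊔_)
open import Algebra.Bundles using (Semigroup)
open import Data.Nat using (ℕ; _>_)
open import Data.List.NonEmpty using (List⁺; toList; foldr₁) renaming (map to map⁺)
open import Data.List.Relation.Unary.Linked using (Linked)
open import Data.Product using (Σ; ∃; _×_)
open import Relation.Nullary using (¬_)
open import Relation.Unary using (Pred)

-- A finite nonempty subset α of ℕ, listed in strictly decreasing order
-- i₁ > i₂ > … > i_k.
record FinSet⁺ : Set where
  constructor mkFinSet⁺
  field
    elems : List⁺ ℕ
    decr  : Linked _>_ (toList elems)

module SemigroupDefs {c ℓ : Level} (G : Semigroup c ℓ) where
  open Semigroup G renaming (Carrier to Car)

  prodα : (ℕ → Car) → FinSet⁺ → Car
  prodα g α = foldr₁ _∙_ (map⁺ g (FinSet⁺.elems α))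

  -- membership in FP(g_i)_{i∈ℕ} (up to the semigroup's equality);
  -- G is a semigroup, so only nonempty α are used.
  FP : (ℕ → Car) → Pred Car ℓ
  FP g x = Σ FinSet⁺ λ α → x ≈ prodα g α

  IsIPSet : ∀ {a} → Pred Car a → Set (c ⊔ ℓ ⊔ a)
  IsIPSet A = Σ (ℕ → Car) λ g → ∀ x → (A x → FP g x) × (FP g x → A x)

  ContainsIPSet : ∀ {a} → Pred Car a → Set (c ⊔ ℓ ⊔ a)
  ContainsIPSet B = Σ (ℕ → Car) λ g → ∀ x → FP g x → B x

  IPStar : ∀ {a} → Pred Car a → Set (c ⊔ ℓ ⊔ a)
  IPStar B = ∀ (g : ℕ → Car) → ∃ λ x → FP g x × B x

  IPStarPositive : ∀ {a} → Pred Car a → Set (c ⊔ ℓ ⊔ a)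
  IPStarPositive B = ¬ IPStar (λ x → ¬ B x)

  ∂ : ∀ {a} → Car → Pred Car a → Pred Car a
  ∂ g A h = A h × A (h ∙ g)

  Δ : ∀ {a} → Pred Car a → Pred Car (c ⊔ ℓ ⊔ a)
  Δ A g = IPStarPositive (∂ g A)

module Submission where

-- Let A = FP(g_i)_{i∈ℕ} be an IP-set and h ∈ A, say h ≈ g_α with maximal
-- index a = max α.  The tail sequence k_i = g_{i+a+1} generates an IP-set
-- FP(k) inside ∂_h A: every k_β equals g_{β+a+1}, hence lies in A, and since
-- all indices of β+a+1 exceed those of α, the product k_β h ≈ g_{β+a+1} g_α
-- is again a finite product g_{(β+a+1) ∪ α}, hence lies in A as well.
--
-- The second half of the
-- theorem, A ⊆ Δ(A), follows from the first because any set containing an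
-- IP-set is IP*-positive: a set in IP* meets that IP-set, so the complement
-- of the set cannot be in IP*.

open import Defs
open import Level using (Level)
open import Algebra.Bundles using (Semigroup)
open import Data.Product using (_×_; _,_; proj₁; proj₂)
open import Relation.Unary using (Pred)
open import Data.Nat using (ℕ; suc; _+_; _>_)
open import Data.Nat.Properties using (+-monoˡ-<; m≤n+m)
open import Data.List using (List; []; _∷_; _++_; map)
open import Data.List.NonEmpty using (_∷_; head) renaming (map to map⁺; toList to toList⁺)
open import Data.List.Relation.Unary.Linked as Linked using (Linked; [-]; _∷_)
import Data.List.Relation.Unary.Linked.Properties as Linkedₚ
open import Data.List.Relation.Unary.All using (All; []; _∷_)
open import Relation.Binary.PropositionalEquality using (_≡_; refl; sym; cong; module ≡-Reasoning)

-- The largest index of α (its elements are listed in decreasing order).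
maxIndex : FinSet⁺ → ℕ
maxIndex α = head (FinSet⁺.elems α)

shiftIndices : ℕ → FinSet⁺ → FinSet⁺
shiftIndices m (mkFinSet⁺ xs d) =
  mkFinSet⁺ (map⁺ (_+ m) xs) (Linkedₚ.map⁺ (Linked.map (+-monoˡ-< m) d))

shiftIndices-above : ∀ a β → All (_> a) (toList⁺ (FinSet⁺.elems (shiftIndices (suc a) β)))
shiftIndices-above a (mkFinSet⁺ (y ∷ ys) _) = m≤n+m (suc a) y ∷ above ys
  where
  above : ∀ zs → All (_> a) (map (_+ suc a) zs)
  above []       = []
  above (z ∷ zs) = m≤n+m (suc a) z ∷ above zs

linked-++-above : ∀ {a as x xs} → Linked _>_ (x ∷ xs) → All (_> a) (x ∷ xs) →
                  Linked _>_ (a ∷ as) → Linked _>_ (x ∷ (xs ++ (a ∷ as)))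
linked-++-above {xs = []}     [-]        (x>a ∷ []) d = x>a ∷ d
linked-++-above {xs = y ∷ ys} (x>y ∷ dx) (_ ∷ ys>a) d = x>y ∷ linked-++-above dx ys>a d

appendAbove : (β α : FinSet⁺) → All (_> maxIndex α) (toList⁺ (FinSet⁺.elems β)) → FinSet⁺
appendAbove (mkFinSet⁺ (x ∷ xs) dβ) (mkFinSet⁺ (a ∷ as) dα) β>α =
  mkFinSet⁺ (x ∷ (xs ++ (a ∷ as))) (linked-++-above dβ β>α dα)

module _ {c ℓ : Level} (G : Semigroup c ℓ) where
  open Semigroup G renaming (Carrier to Car; refl to ≈-refl; sym to ≈-sym; trans to ≈-trans)
  open SemigroupDefs G

  listProd : (ℕ → Car) → ℕ → List ℕ → Car
  listProd g x []       = g x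
  listProd g x (y ∷ ys) = g x ∙ listProd g y ys

  prodα-listProd : ∀ g x xs d → prodα g (mkFinSet⁺ (x ∷ xs) d) ≡ listProd g x xs
  prodα-listProd g x []       d = refl
  prodα-listProd g x (y ∷ ys) (_ ∷ d) = cong (g x ∙_) (prodα-listProd g y ys d)

  listProd-++ : ∀ g a as x xs → listProd g x (xs ++ (a ∷ as)) ≈ listProd g x xs ∙ listProd g a as
  listProd-++ g a as x []       = ≈-refl
  listProd-++ g a as x (y ∷ ys) =
    ≈-trans (∙-congˡ (listProd-++ g a as y ys)) (≈-sym (assoc _ _ _))

  tailSeq : (ℕ → Car) → ℕ → ℕ → Car
  tailSeq g m i = g (i + m)

  listProd-tailSeq : ∀ g m x xs → listProd (tailSeq g m) x xs ≡ listProd g (x + m) (map (_+ m) xs)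
  listProd-tailSeq g m x []       = refl
  listProd-tailSeq g m x (y ∷ ys) = cong (g (x + m) ∙_) (listProd-tailSeq g m y ys)

  prodα-tailSeq : ∀ g m β → prodα (tailSeq g m) β ≡ prodα g (shiftIndices m β)
  prodα-tailSeq g m β@(mkFinSet⁺ (x ∷ xs) d) = begin
    prodα (tailSeq g m) β                   ≡⟨ prodα-listProd (tailSeq g m) x xs d ⟩
    listProd (tailSeq g m) x xs             ≡⟨ listProd-tailSeq g m x xs ⟩
    listProd g (x + m) (map (_+ m) xs)      ≡⟨ sym (prodα-listProd g (x + m) (map (_+ m) xs) d⁺) ⟩
    prodα g (shiftIndices m β)              ∎
    where
    d⁺ : Linked _>_ ((x + m) ∷ map (_+ m) xs)
    d⁺ = FinSet⁺.decr (shiftIndices m β)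
    open ≡-Reasoning

  prodα-appendAbove : ∀ g β α β>α → prodα g (appendAbove β α β>α) ≈ prodα g β ∙ prodα g α
  prodα-appendAbove g (mkFinSet⁺ (x ∷ xs) dβ) (mkFinSet⁺ (a ∷ as) dα) β>α = begin
    prodα g (mkFinSet⁺ (x ∷ (xs ++ (a ∷ as))) d) ≈⟨ reflexive (prodα-listProd g x (xs ++ (a ∷ as)) d) ⟩
    listProd g x (xs ++ (a ∷ as))                 ≈⟨ listProd-++ g a as x xs ⟩
    listProd g x xs ∙ listProd g a as
      ≈⟨ ≈-sym (∙-cong (reflexive (prodα-listProd g x xs dβ))
                       (reflexive (prodα-listProd g a as dα))) ⟩
    prodα g (mkFinSet⁺ (x ∷ xs) dβ) ∙ prodα g (mkFinSet⁺ (a ∷ as) dα) ∎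
    where
    d : Linked _>_ (x ∷ (xs ++ (a ∷ as)))
    d = linked-++-above dβ β>α dα
    open import Relation.Binary.Reasoning.Setoid setoid

  FP-resp-≈ : ∀ {g x y} → x ≈ y → FP g y → FP g x
  FP-resp-≈ x≈y (β , y≈gβ) = β , ≈-trans x≈y y≈gβ

  FP-tail : ∀ g α {x} → FP (tailSeq g (suc (maxIndex α))) x →
            FP g x × FP g (x ∙ prodα g α)
  FP-tail g α {x} (β , x≈) =
      (β⁺ , x≈gβ⁺)
    , (appendAbove β⁺ α β⁺>α
      , ≈-trans (∙-congʳ x≈gβ⁺) (≈-sym (prodα-appendAbove g β⁺ α β⁺>α)))
    where
    β⁺ : FinSet⁺
    β⁺ = shiftIndices (suc (maxIndex α)) β

    β⁺>α : All (_> maxIndex α) (toList⁺ (FinSet⁺.elems β⁺))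
    β⁺>α = shiftIndices-above (maxIndex α) β

    x≈gβ⁺ : x ≈ prodα g β⁺
    x≈gβ⁺ = ≈-trans x≈ (reflexive (prodα-tailSeq g _ β))

  ∂-containsIPSet : ∀ {a} (A : Pred Car a) → IsIPSet A → ∀ h → A h → ContainsIPSet (∂ h A)
  ∂-containsIPSet A (g , A⇔FP) h Ah = tailSeq g (suc (maxIndex α)) , inside
    where
    FP⇒A : ∀ {y} → FP g y → A y
    FP⇒A {y} = proj₂ (A⇔FP y)

    α : FinSet⁺
    α = proj₁ (proj₁ (A⇔FP h) Ah)

    h≈gα : h ≈ prodα g α
    h≈gα = proj₂ (proj₁ (A⇔FP h) Ah)

    inside : ∀ x → FP (tailSeq g (suc (maxIndex α))) x → ∂ h A x
    inside x fp = let (x∈FP , xgα∈FP) = FP-tail g α fp in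
      FP⇒A x∈FP , FP⇒A (FP-resp-≈ (∙-congˡ h≈gα) xgα∈FP)

  containsIPSet⇒positive : ∀ {b} (B : Pred Car b) → ContainsIPSet B → IPStarPositive B
  containsIPSet⇒positive B (k , FPk⊆B) ¬B∈IP* =
    let (x , x∈FPk , x∉B) = ¬B∈IP* k in x∉B (FPk⊆B x x∈FPk)

mainTheorem3 : {c ℓ a : Level} (G : Semigroup c ℓ) (A : Pred (Semigroup.Carrier G) a) →
    SemigroupDefs.IsIPSet G A →
    ((g : Semigroup.Carrier G) → A g → SemigroupDefs.ContainsIPSet G (SemigroupDefs.∂ G g A))
    × ((g : Semigroup.Carrier G) → A g → SemigroupDefs.Δ G A g)
mainTheorem3 G A A-IP =
    ∂-containsIPSet G A A-IP
  , λ h Ah → containsIPSet⇒positive G (SemigroupDefs.∂ G h A) (∂-containsIPSet G A A-IP h Ah)
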